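{- Let $n\ge 2$, let $H$ be a graph with $og(H)>n$, and let $R\neq\emptyset$ be an $n$-ary relation over $V_H$ such that $\mathrm{pPol}(E_H)\subseteq\mathrm{pPol}(R)$. If for all $(x_1,\dots,x_n)\in (V_H)^n$, $(x_1,\dots,x_n)\in R$ implies $(x_1,x_2)\in E_H$, then $R$ qfpp-defines $E_H$.
   Context: Graphs are finite, simple, undirected, loopless. $og(H)$ is the size of a smallest induced odd cycle of $H$ ($\infty$ if $H$ is bipartite). $\mathrm{pPol}(R)$: the set of partial functions $f:\mathrm{dom}(f)\to V$, $\mathrm{dom}(f)\subseteq V^m$, such that for every matrix with all columns in $R$ and all rows in $\mathrm{dom}(f)$, applying $f$ row-wise yields a column in $R$. A relation $R'$ of arity $r$ over $V$ is qfpp-definable from $R$ if $R'(x_1,\dots,x_r)\equiv R(\mathbf{x}_1)\wedge\dots\wedge R(\mathbf{x}_p)\wedge \mathrm{EQ}(\mathbf{y}_1)\wedge\dots\wedge\mathrm{EQ}(\mathbf{y}_q)$ for some tuples $\mathbf{x}_i$ (of length the arity of $R$) and pairs $\mathbf{y}_i$ of variables among $x_1,\dots,x_r$ (no existential quantifiers), where $\mathrm{EQ}=\{(x,x):x\in V\}$. -}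

module Defs where

open import Data.Nat using (ℕ; zero; suc; _≤_; _%_; s≤s; z≤n)
open import Data.Fin using (Fin; toℕ) renaming (zero to fzero; suc to fsuc)
open import Data.Bool using (Bool; T; false)
open import Data.Product using (Σ; _×_; _,_; ∃)
open import Data.Sum using (_⊎_)
open import Relation.Binary.PropositionalEquality using (_≡_)
open import Relation.Nullary using (¬_)
open import Function using (_∘_; Injective)
open import Function.Bundles using (_⇔_)

record Graph : Set where
  field
    N      : ℕ
    adj    : Fin N → Fin N → Bool
    sym    : ∀ x y → adj x y ≡ adj y x
    irrefl : ∀ x → adj x x ≡ false

module _ (H : Graph) where
  open Graph H

  V : Set
  V = Fin N

  E : V → V → Set
  E x y = T (adj x y)

Rel : Set → ℕ → Set₁
Rel A r = (Fin r → A) → Set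

EH : (H : Graph) → Rel (V H) 2
EH H t = E H (t fzero) (t (fsuc fzero))

CycSucc : (k : ℕ) → Fin k → Fin k → Set
CycSucc k i j = (suc (toℕ i) ≡ toℕ j) ⊎ ((suc (toℕ i) ≡ k) × (toℕ j ≡ 0))

CycAdj : (k : ℕ) → Fin k → Fin k → Set
CycAdj k i j = CycSucc k i j ⊎ CycSucc k j i

InducedCycle : Graph → ℕ → Set
InducedCycle H k =
  Σ (Fin k → V H) λ c → Injective _≡_ _≡_ c ×
    (∀ i j → (E H (c i) (c j) ⇔ CycAdj k i j))

-- og(H) > n : every induced odd cycle of H has length > n
-- (vacuous when H is bipartite, i.e. og(H) = ∞)
OddGirthGT : Graph → ℕ → Set
OddGirthGT H n =
  ∀ k → 3 ≤ k → k % 2 ≡ 1 → k ≤ n → ¬ InducedCycle H k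

-- A partial m-ary function on A is given by its
-- domain dom ⊆ A^m (as a Boolean predicate) and its values on the domain.
-- f preserves the r-ary relation R: for every r×m matrix M whose columns
-- are in R and whose rows are in dom, the column obtained by applying f
-- row-wise is in R.
Preserves : {A : Set} {r m : ℕ} → Rel A r →
            (dom : (Fin m → A) → Bool) → ((t : Fin m → A) → T (dom t) → A) → Set
Preserves {A} {r} {m} R dom f =
  (M : Fin r → Fin m → A) →
  (∀ j → R (λ i → M i j)) →
  (rows : ∀ i → T (dom (M i))) →
  R (λ i → f (M i) (rows i))

PPolSubset : {A : Set} {s r : ℕ} → Rel A s → Rel A r → Set
PPolSubset {A} S R =
  ∀ (m : ℕ) (dom : (Fin m → A) → Bool) (f : (t : Fin m → A) → T (dom t) → A) →
  Preserves S dom f → Preserves R dom f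

-- R' (arity r) is qfpp-definable from R (arity n):
-- R'(x) ≡ R(x_{σ1}) ∧ … ∧ R(x_{σp}) ∧ EQ(x_{a1},x_{b1}) ∧ … ∧ EQ(x_{aq},x_{bq})
QfppDefines : {A : Set} {n r : ℕ} → Rel A n → Rel A r → Set
QfppDefines {A} {n} {r} R R' =
  Σ ℕ λ p → Σ (Fin p → Fin n → Fin r) λ σ →
  Σ ℕ λ q → Σ (Fin q → Fin r × Fin r) λ ys →
  ∀ (t : Fin r → A) →
    R' t ⇔ ((∀ i → R (t ∘ σ i)) ×
            (∀ j → t (Data.Product.proj₁ (ys j)) ≡ t (Data.Product.proj₂ (ys j))))

idx₁ : ∀ {n} → 2 ≤ n → Fin n
idx₁ (s≤s (s≤s _)) = fzero

idx₂ : ∀ {n} → 2 ≤ n → Fin n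
idx₂ (s≤s (s≤s _)) = fsuc fzero

{-# OPTIONS --safe #-}
module Submission where

open import Defs
open import Data.Nat using (ℕ; _≤_)
open import Data.Fin using (Fin)
open import Data.Product using (∃)

-- Fix t ∈ R and let S be the set of its entries, so |S| ≤ n. A shortest odd closed walk
-- inside S has no repeated vertex and no chord (either would split it into two shorter
-- closed walks, one of them odd), so it is an induced odd cycle of length ≤ n. As og(H) > n
-- there is none, and a union–find over the edges of H[S] produces a proper 2-colouring c of
-- H[S]. Then E_H(x₀, x₁) ⟺ R(x_{c(t₁)}, …, x_{c(tₙ)}): for an edge (x₀, x₁), the map
-- v ↦ x_{c(v)} on S is a unary partial polymorphism of E_H, hence of R, and it sends t to the
-- right-hand tuple; conversely that tuple starts with x_{c(t₁)}, x_{c(t₂)}, which are x₀ and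
-- x₁ in some order because t₁t₂ is an edge.

open import Algebra using (CommutativeRing)
open import Data.Bool using (Bool; true; false; not; _xor_; T)
open import Data.Bool.Properties
  using (not-involutive; not-distribˡ-xor; not-¬; xor-annihilates-not; xor-inverseʳ;
         xor-∧-commutativeRing)
  renaming (_≟_ to _≟ᵇ_)
open import Data.Empty using (⊥; ⊥-elim)
open import Data.Fin using (toℕ) renaming (zero to fzero; suc to fsuc; _≟_ to _≟ᶠ_)
open import Data.Fin.Properties using (2↔Bool; any?; injective⇒≤; toℕ-injective; toℕ<n)
open import Data.List using ([]; _∷_; allFin; cartesianProduct)
open import Data.List.Membership.Propositional.Properties using (∈-allFin; ∈-cartesianProduct⁺)
open import Data.List.Relation.Unary.All as All using (All; []; _∷_)
open import Data.Nat using (zero; suc; _+_; _<_; _%_; _/_; s≤s; z≤n)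
open import Data.Nat.DivMod
  using (m≡m%n+[m/n]*n; [m+kn]%n≡m%n; [m+n]%n≡m%n; %-congˡ; m%n<n; m<n⇒m%n≡m; n%n≡0)
open import Data.Nat.Induction using (<-rec)
open import Data.Nat.Properties
  using (≤-pred; ≤-refl; <-cmp; m≤n⇒m<n∨m≡n; m<n⇒m<1+n; m≤n⇒∃[o]m+o≡n; +-comm; +-suc;
         m<m+n; m<n+m)
open import Data.Nat.Tactic.RingSolver using (solve-∀)
open import Data.Product using (Σ; _×_; _,_; proj₁; proj₂; ∃₂)
open import Data.Sum as Sum using (_⊎_; inj₁; inj₂)
open import Function using (Injective; Inverse; Equivalence; _⇔_; mk⇔; _∘_; id)
open import Relation.Binary using (Symmetric; Decidable; tri<; tri≈; tri>)
open import Relation.Binary.PropositionalEquality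
open import Relation.Nullary using (¬_; Dec; yes; no)
open import Relation.Nullary.Decidable using (isYes; toWitness; fromWitness; T?; _×-dec_)

open import Algebra.Properties.Group (CommutativeRing.+-group xor-∧-commutativeRing)
  using () renaming (∙-cancelˡ to xor-cancelˡ)

[x⊕¬y]⊕y≡¬x : ∀ x y → (x xor not y) xor y ≡ not x
[x⊕¬y]⊕y≡¬x false false = refl
[x⊕¬y]⊕y≡¬x false true  = refl
[x⊕¬y]⊕y≡¬x true  false = refl
[x⊕¬y]⊕y≡¬x true  true  = refl

odd : ℕ → Bool
odd zero    = false
odd (suc n) = not (odd n)

odd-+ : ∀ m n → odd (m + n) ≡ odd m xor odd n
odd-+ zero    n = refl
odd-+ (suc m) n = trans (cong not (odd-+ m n)) (not-distribˡ-xor (odd m) (odd n))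

odd[m+n]⇒odd[m]⊎odd[n] : ∀ m n → odd (m + n) ≡ true → odd m ≡ true ⊎ odd n ≡ true
odd[m+n]⇒odd[m]⊎odd[n] m n odd-m+n with odd m | odd-+ m n
... | true  | _  = inj₁ refl
... | false | eq = inj₂ (trans (sym eq) odd-m+n)

odd⇒%2≡1 : ∀ n → odd n ≡ true → n % 2 ≡ 1
odd⇒%2≡1 zero          ()
odd⇒%2≡1 (suc zero)    _     = refl
odd⇒%2≡1 (suc (suc n)) odd-n = odd⇒%2≡1 n (trans (sym (not-involutive (odd n))) odd-n)

[1+k]%[1+m] : ∀ k m → (k % suc m < m × suc k % suc m ≡ suc (k % suc m))
                    ⊎ (k % suc m ≡ m × suc k % suc m ≡ 0)
[1+k]%[1+m] k m =
  Sum.map (λ r<m → r<m , trans reduce (m<n⇒m%n≡m (s≤s r<m)))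
          (λ r≡m → r≡m , trans reduce (trans (cong (λ r → suc r % suc m) r≡m)
                                             (n%n≡0 (suc m))))
          (m≤n⇒m<n∨m≡n (≤-pred (m%n<n k (suc m))))
  where
  reduce : suc k % suc m ≡ suc (k % suc m) % suc m
  reduce = trans (%-congˡ {o = suc m} (cong suc (m≡m%n+[m/n]*n k (suc m))))
                 ([m+kn]%n≡m%n (suc (k % suc m)) (k / suc m) (suc m))

-- A closed walk of length L, unrolled into an L-periodic sequence of vertices.
record IsClosedWalk {V : Set} (_~_ : V → V → Set) (L : ℕ) (s : ℕ → V) : Set where
  field
    edge     : ∀ k → s k ~ s (suc k)
    periodic : ∀ k → s (k + L) ≡ s k

data Walk {V : Set} (_~_ : V → V → Set) : V → V → ℕ → Set where
  []  : ∀ {i} → Walk _~_ i i 0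
  _∷_ : ∀ {i j k ℓ} → i ~ j → Walk _~_ j k ℓ → Walk _~_ i k (suc ℓ)

module _ {V : Set} {_~_ : V → V → Set} where
  private variable
    i j k : V
    ℓ ℓ′  : ℕ

  unroll : (t : ℕ → V) (m : ℕ) → (∀ k → k < m → t k ~ t (suc k)) → t m ~ t 0 →
           IsClosedWalk _~_ (suc m) (λ k → t (k % suc m))
  unroll t m path closing = record
    { edge     = edge
    ; periodic = λ k → cong t ([m+n]%n≡m%n k (suc m))
    }
    where
    edge : ∀ k → t (k % suc m) ~ t (suc k % suc m)
    edge k with [1+k]%[1+m] k m
    ... | inj₁ (r<m , eq) = subst (λ i → t (k % suc m) ~ t i) (sym eq) (path (k % suc m) r<m)
    ... | inj₂ (r≡m , eq) = subst₂ (λ i j → t i ~ t j) (sym r≡m) (sym eq) closing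

  shortcut : ∀ {L s} → IsClosedWalk _~_ L s → ∀ m p → s (m + p) ~ s p →
             IsClosedWalk _~_ (suc m) (λ k → s (k % suc m + p))
  shortcut {s = s} closed m p =
    unroll (λ k → s (k + p)) m (λ k _ → IsClosedWalk.edge closed (k + p))

  infixr 5 _++_

  _++_ : Walk _~_ i j ℓ → Walk _~_ j k ℓ′ → Walk _~_ i k (ℓ + ℓ′)
  []      ++ w′ = w′
  (e ∷ w) ++ w′ = e ∷ (w ++ w′)

  _∷ʳ_ : Walk _~_ i j ℓ → j ~ k → Walk _~_ i k (suc ℓ)
  []       ∷ʳ e = e ∷ []
  (e′ ∷ w) ∷ʳ e = e′ ∷ (w ∷ʳ e)

  reverse : Symmetric _~_ → Walk _~_ i j ℓ → Walk _~_ j i ℓ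
  reverse ~-sym []      = []
  reverse ~-sym (e ∷ w) = reverse ~-sym w ∷ʳ ~-sym e

  vertexAt : Walk _~_ i j ℓ → ℕ → V
  vertexAt {i = i} _       zero    = i
  vertexAt {j = j} []      (suc _) = j
  vertexAt         (_ ∷ w) (suc k) = vertexAt w k

  vertexAt-end : (w : Walk _~_ i j ℓ) → vertexAt w ℓ ≡ j
  vertexAt-end []      = refl
  vertexAt-end (_ ∷ w) = vertexAt-end w

  vertexAt-edge : (w : Walk _~_ i j ℓ) → ∀ k → k < ℓ → vertexAt w k ~ vertexAt w (suc k)
  vertexAt-edge (e ∷ w) zero    _         = e
  vertexAt-edge (_ ∷ w) (suc k) (s≤s k<ℓ) = vertexAt-edge w k k<ℓ

  closedWalk : (w : Walk _~_ i i (suc ℓ)) →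
               IsClosedWalk _~_ (suc ℓ) (λ k → vertexAt w (k % suc ℓ))
  closedWalk {ℓ = ℓ} w =
    unroll (vertexAt w) ℓ (λ k k<ℓ → vertexAt-edge w k (m<n⇒m<1+n k<ℓ))
           (subst (vertexAt w ℓ ~_) (vertexAt-end w) (vertexAt-edge w ℓ ≤-refl))

module Bipartition {m : ℕ} {_~_ : Fin m → Fin m → Set}
                   (~-sym : Symmetric _~_) (_~?_ : Decidable _~_) where

  OddClosedWalk : Set
  OddClosedWalk = ∃₂ λ r ℓ → odd ℓ ≡ true × Walk _~_ r r ℓ

  ProperColouring : Set
  ProperColouring = Σ (Fin m → Bool) λ c → ∀ {i j} → i ~ j → c i ≢ c j

  -- Union–find over the edges with parities: every vertex keeps a walk from the
  -- root of its tree, and its colour is the parity of that walk.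
  record Branch (x : Fin m) : Set where
    constructor branch
    field
      {root}  : Fin m
      {depth} : ℕ
      path    : Walk _~_ root x depth

  open Branch

  Opposite : ∀ {x y} → Branch x → Branch y → Set
  Opposite b b′ = root b ≡ root b′ × odd (depth b) ≢ odd (depth b′)

  Forest : Set
  Forest = (x : Fin m) → Branch x

  Respects : Forest → Fin m × Fin m → Set
  Respects F (u , v) = u ~ v → Opposite (F u) (F v)

  colour : Forest → Fin m → Bool
  colour F x = odd (depth (F x))

  module _ (F : Forest) {u v : Fin m} (e : u ~ v) where

    ℓ-bridge : ℕ
    ℓ-bridge = depth (F u) + suc (depth (F v))

    bridge : Walk _~_ (root (F u)) (root (F v)) ℓ-bridge
    bridge = path (F u) ++ e ∷ reverse ~-sym (path (F v))

    odd-bridge : odd ℓ-bridge ≡ colour F u xor not (colour F v)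
    odd-bridge = odd-+ (depth (F u)) (suc (depth (F v)))

    oddClosedWalk : root (F u) ≡ root (F v) → colour F u ≡ colour F v → OddClosedWalk
    oddClosedWalk roots≡ colours≡ =
      root (F u) , ℓ-bridge , parity ,
      subst (λ r → Walk _~_ (root (F u)) r ℓ-bridge) (sym roots≡) bridge
      where
      parity : odd ℓ-bridge ≡ true
      parity = begin
        odd ℓ-bridge                     ≡⟨ odd-bridge ⟩
        colour F u xor not (colour F v)  ≡⟨ cong (_xor not (colour F v)) colours≡ ⟩
        colour F v xor not (colour F v)  ≡⟨ xor-inverseʳ (colour F v) ⟩
        true                             ∎
        where open ≡-Reasoning

    -- Hang the tree of v below u, through the edge e.
    module Graft (roots≢ : root (F u) ≢ root (F v)) where

      graft : ∀ {x} → Branch x → Branch x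
      graft (branch {r} p) with r ≟ᶠ root (F v)
      ... | yes refl = branch (bridge ++ p)
      ... | no _     = branch p

      F′ : Forest
      F′ x = graft (F x)

      graft-cases : ∀ {x} (b : Branch x) →
        (root b ≡ root (F v) × root (graft b) ≡ root (F u) ×
         odd (depth (graft b)) ≡ odd ℓ-bridge xor odd (depth b))
        ⊎ (root b ≢ root (F v) × graft b ≡ b)
      graft-cases (branch {r} {d} p) with r ≟ᶠ root (F v)
      ... | yes refl = inj₁ (refl , refl , odd-+ ℓ-bridge d)
      ... | no r≢    = inj₂ (r≢ , refl)

      respects-old : ∀ {pair} → Respects F pair → Respects F′ pair
      respects-old {y , z} resp y~z with resp y~z | graft-cases (F y) | graft-cases (F z)
      ... | _ , colours≢ | inj₁ (_ , ry , cy) | inj₁ (_ , rz , cz) =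
        trans ry (sym rz) ,
        λ eq → colours≢ (xor-cancelˡ (odd ℓ-bridge) _ _ (trans (sym cy) (trans eq cz)))
      ... | opposite | inj₂ (_ , gy) | inj₂ (_ , gz) =
        subst₂ Opposite (sym gy) (sym gz) opposite
      ... | roots≡ , _ | inj₁ (y-moved , _) | inj₂ (z-stays , _) =
        ⊥-elim (z-stays (trans (sym roots≡) y-moved))
      ... | roots≡ , _ | inj₂ (y-stays , _) | inj₁ (z-moved , _) =
        ⊥-elim (y-stays (trans roots≡ z-moved))

      respects-new : Respects F′ (u , v)
      respects-new _ with graft-cases (F u) | graft-cases (F v)
      ... | inj₁ (u-moved , _) | _                  = ⊥-elim (roots≢ u-moved)
      ... | _                  | inj₂ (v-stays , _) = ⊥-elim (v-stays refl)
      ... | inj₂ (_ , gu)      | inj₁ (_ , rv , cv) =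
        subst (λ b → Opposite b (F′ v)) (sym gu)
              (sym rv , λ eq → not-¬ refl (trans eq (trans cv flip)))
        where
        flip : odd ℓ-bridge xor colour F v ≡ not (colour F u)
        flip = trans (cong (_xor colour F v) odd-bridge) ([x⊕¬y]⊕y≡¬x (colour F u) (colour F v))

  extend : ∀ {pairs} (F : Forest) → All (Respects F) pairs → ∀ u v →
           OddClosedWalk ⊎ Σ Forest λ F′ → All (Respects F′) ((u , v) ∷ pairs)
  extend F resp u v with u ~? v
  ... | no ¬e = inj₂ (F , (λ e → ⊥-elim (¬e e)) ∷ resp)
  ... | yes e with root (F u) ≟ᶠ root (F v)
  ...   | no roots≢ = inj₂ (F′ , respects-new ∷ All.map respects-old resp)
    where open Graft F e roots≢
  ...   | yes roots≡ with colour F u ≟ᵇ colour F v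
  ...     | yes colours≡ = inj₁ (oddClosedWalk F e roots≡ colours≡)
  ...     | no colours≢  = inj₂ (F , (λ _ → roots≡ , colours≢) ∷ resp)

  forest : ∀ pairs → OddClosedWalk ⊎ Σ Forest λ F → All (Respects F) pairs
  forest []             = inj₂ ((λ _ → branch []) , [])
  forest ((u , v) ∷ ps) with forest ps
  ... | inj₁ w        = inj₁ w
  ... | inj₂ (F , rs) = extend F rs u v

  bipartition : OddClosedWalk ⊎ ProperColouring
  bipartition = Sum.map₂ colouring (forest (cartesianProduct (allFin m) (allFin m)))
    where
    colouring : Σ Forest (λ F → All (Respects F) _) → ProperColouring
    colouring (F , rs) = colour F ,
      λ {i} {j} e → proj₂ (All.lookup rs (∈-cartesianProduct⁺ (∈-allFin i) (∈-allFin j)) e)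

<-<-gaps : ∀ {i j L} → i < j → j < L →
           ∃₂ λ d e → j ≡ suc d + i × L ≡ suc d + suc (e + i)
<-<-gaps {i} i<j j<L with m≤n⇒∃[o]m+o≡n i<j | m≤n⇒∃[o]m+o≡n j<L
... | d , refl | e , refl = d , e , cong suc (+-comm i d) , rearrange i d e
  where
  rearrange : ∀ i d e → suc (suc i + d) + e ≡ suc d + suc (e + i)
  rearrange = solve-∀

InImage : ∀ {A : Set} {n} → (Fin n → A) → A → Set
InImage t a = ∃ λ j → t j ≡ a

injective-into-image⇒≤ : ∀ {A : Set} {L n} {c : Fin L → A} (t : Fin n → A) →
  Injective _≡_ _≡_ c → (∀ i → InImage t (c i)) → L ≤ n
injective-into-image⇒≤ t c-injective c-in-t = injective⇒≤ λ {i} {i′} eq →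
  c-injective (trans (sym (proj₂ (c-in-t i))) (trans (cong t eq) (proj₂ (c-in-t i′))))

bit : Bool → Fin 2
bit = Inverse.from 2↔Bool

module _ (H : Graph) where

  E-sym : ∀ {x y} → E H x y → E H y x
  E-sym {x} {y} = subst T (Graph.sym H x y)

  E-irrefl : ∀ {x} → ¬ E H x x
  E-irrefl {x} = subst T (Graph.irrefl H x)

  -- The walk s p, s (1 + p), …, s (m + p) closed up by the edge back to s p would be an odd
  -- closed walk of length 1 + m < L.
  NoShorterOddCycle : ℕ → (ℕ → V H) → Set
  NoShorterOddCycle L s = ∀ m p → suc m < L → odd (suc m) ≡ true → ¬ E H (s (m + p)) (s p)

  module ShortestOddClosedWalk {L s} (closed : IsClosedWalk (E H) L s) (odd-L : odd L ≡ true)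
                               (shortest : NoShorterOddCycle L s) where
    open IsClosedWalk closed

    wrap-around : ∀ a b p → L ≡ b + a → s (a + (b + p)) ≡ s p
    wrap-around a b p L≡ =
      trans (cong s (trans (rearrange a b p) (cong (p +_) (sym L≡)))) (periodic p)
      where
      rearrange : ∀ a b p → a + (b + p) ≡ p + (b + a)
      rearrange = solve-∀

    -- The two arcs between the visits are closed walks with lengths adding up to L.
    no-repeat : ∀ p d e → L ≡ suc d + suc e → s p ≢ s (suc d + p)
    no-repeat p d e L≡ repeat =
      Sum.[ first-arc , second-arc ] (odd[m+n]⇒odd[m]⊎odd[n] (suc d) (suc e) odd-sum)
      where
      odd-sum : odd (suc d + suc e) ≡ true
      odd-sum = trans (cong odd (sym L≡)) odd-L

      first-arc : odd (suc d) ≡ true → ⊥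
      first-arc odd-d = shortest d p (subst (suc d <_) (sym L≡) (m<m+n (suc d) (s≤s z≤n))) odd-d
        (subst (E H (s (d + p))) (sym repeat) (edge (d + p)))

      second-arc : odd (suc e) ≡ true → ⊥
      second-arc odd-e =
        shortest e (suc d + p) (subst (suc e <_) (sym L≡) (m<n+m (suc e) (s≤s z≤n))) odd-e
          (subst (E H (s (e + (suc d + p)))) (trans (wrap-around (suc e) (suc d) p L≡) repeat)
                 (edge (e + (suc d + p))))

    -- A chord closes up both arcs between its ends, giving closed walks with lengths
    -- adding up to L + 2.
    no-chord : ∀ p d e → L ≡ 2 + d + (2 + e) → ¬ E H (s p) (s (2 + d + p))
    no-chord p d e L≡ chord =
      Sum.[ first-arc , second-arc ] (odd[m+n]⇒odd[m]⊎odd[n] (3 + d) (3 + e) odd-sum)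
      where
      odd-sum : odd (3 + d + (3 + e)) ≡ true
      odd-sum = begin
        odd (3 + d + (3 + e))                    ≡⟨ odd-+ (3 + d) (3 + e) ⟩
        not (odd (2 + d)) xor not (odd (2 + e))  ≡⟨ xor-annihilates-not (odd (2 + d)) _ ⟩
        odd (2 + d) xor odd (2 + e)              ≡⟨ sym (odd-+ (2 + d) (2 + e)) ⟩
        odd (2 + d + (2 + e))                    ≡⟨ cong odd (sym L≡) ⟩
        odd L                                    ≡⟨ odd-L ⟩
        true                                     ∎
        where open ≡-Reasoning

      3+d<L : 3 + d < L
      3+d<L = subst (3 + d <_) (trans (cong (2 +_) (sym (+-suc d (suc e)))) (sym L≡))
                    (m<m+n (3 + d) (s≤s z≤n))

      3+e<L : 3 + e < L
      3+e<L = subst (3 + e <_) (trans (cong suc (+-suc d (2 + e))) (sym L≡))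
                    (m<n+m (3 + e) (s≤s z≤n))

      first-arc : odd (3 + d) ≡ true → ⊥
      first-arc odd-d = shortest (2 + d) p 3+d<L odd-d (E-sym chord)

      second-arc : odd (3 + e) ≡ true → ⊥
      second-arc odd-e = shortest (2 + e) (2 + d + p) 3+e<L odd-e
        (subst (λ x → E H x (s (2 + d + p))) (sym (wrap-around (2 + e) (2 + d) p L≡)) chord)

    distinct : ∀ {i j} → i < j → j < L → s i ≢ s j
    distinct i<j j<L with <-<-gaps i<j j<L
    ... | d , e , refl , L≡ = no-repeat _ d (e + _) L≡

    adjacent : ∀ {i j} → i < j → j < L → E H (s i) (s j) →
               suc i ≡ j ⊎ (suc j ≡ L × i ≡ 0)
    adjacent {i} i<j j<L ij with <-<-gaps i<j j<L
    ... | zero  , _     , refl , _  = inj₁ refl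
    ... | suc d , suc e , refl , L≡ = ⊥-elim (no-chord i d (e + i) L≡ ij)
    ... | suc d , zero  , refl , L≡ with i
    ...   | zero   = inj₂ (trans (sym (+-suc (2 + d) 0)) (sym L≡) , refl)
    ...   | suc i′ = ⊥-elim (no-chord (suc i′) d i′ L≡ ij)

    cycle : Fin L → V H
    cycle i = s (toℕ i)

    cycle-injective : Injective _≡_ _≡_ cycle
    cycle-injective {i} {j} eq with <-cmp (toℕ i) (toℕ j)
    ... | tri< i<j _ _ = ⊥-elim (distinct i<j (toℕ<n j) eq)
    ... | tri≈ _ i≡j _ = toℕ-injective i≡j
    ... | tri> _ _ j<i = ⊥-elim (distinct j<i (toℕ<n i) (sym eq))

    edge⇒adj : ∀ i j → E H (cycle i) (cycle j) → CycAdj L i j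
    edge⇒adj i j ij with <-cmp (toℕ i) (toℕ j)
    ... | tri< i<j _ _ = Sum.map inj₁ inj₂ (adjacent i<j (toℕ<n j) ij)
    ... | tri≈ _ i≡j _ = ⊥-elim (E-irrefl (subst (λ k → E H (cycle i) (s k)) (sym i≡j) ij))
    ... | tri> _ _ j<i = Sum.swap (Sum.map inj₁ inj₂ (adjacent j<i (toℕ<n i) (E-sym ij)))

    succ⇒edge : ∀ i j → CycSucc L i j → E H (cycle i) (cycle j)
    succ⇒edge i j (inj₁ 1+i≡j) = subst (λ k → E H (cycle i) (s k)) 1+i≡j (edge (toℕ i))
    succ⇒edge i j (inj₂ (1+i≡L , j≡0)) = subst (E H (cycle i)) wrap (edge (toℕ i))
      where
      wrap : s (suc (toℕ i)) ≡ s (toℕ j)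
      wrap = trans (cong s 1+i≡L) (trans (periodic 0) (cong s (sym j≡0)))

    inducedCycle : InducedCycle H L
    inducedCycle = cycle , cycle-injective ,
      λ i j → mk⇔ (edge⇒adj i j) Sum.[ succ⇒edge i j , E-sym ∘ succ⇒edge j i ]

  no-odd-closed-walk-within : ∀ {n} → OddGirthGT H n → (t : Fin n → V H) →
    ∀ L s → odd L ≡ true → IsClosedWalk (E H) L s → (∀ k → InImage t (s k)) → ⊥
  no-odd-closed-walk-within og t = <-rec P go
    where
    P : ℕ → Set
    P L = ∀ s → odd L ≡ true → IsClosedWalk (E H) L s → (∀ k → InImage t (s k)) → ⊥

    go : ∀ L → (∀ {L′} → L′ < L → P L′) → P L
    go 0 _ _ () _ _
    go 1 _ s _  closed _ = E-irrefl (subst (E H (s 0)) (periodic 0) (edge 0))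
      where open IsClosedWalk closed
    go 2 _ _ () _ _
    go L@(suc (suc (suc _))) shorter s odd-L closed s-in-t =
      og L (s≤s (s≤s (s≤s z≤n))) (odd⇒%2≡1 L odd-L)
         (injective-into-image⇒≤ t cycle-injective (s-in-t ∘ toℕ)) inducedCycle
      where
      no-shorter : NoShorterOddCycle L s
      no-shorter m p m<L odd-m closing =
        shorter m<L _ odd-m (shortcut closed m p closing) (λ k → s-in-t (k % suc m + p))
      open ShortestOddClosedWalk closed odd-L no-shorter

  inImage? : ∀ {n} (t : Fin n → V H) v → Dec (InImage t v)
  inImage? t v = any? λ j → t j ≟ᶠ v

  EdgeWithin : (V H → Set) → V H → V H → Set
  EdgeWithin S u w = S u × S w × E H u w

  bipartiteWithin : ∀ {n} → OddGirthGT H n → (t : Fin n → V H) →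
    Σ (V H → Bool) λ c → ∀ {u w} → EdgeWithin (InImage t) u w → c u ≢ c w
  bipartiteWithin og t = Sum.[ ⊥-elim ∘ impossible , id ] bipartition
    where
    within-sym : Symmetric (EdgeWithin (InImage t))
    within-sym (u-in-t , w-in-t , uw) = w-in-t , u-in-t , E-sym uw

    within? : Decidable (EdgeWithin (InImage t))
    within? u w = inImage? t u ×-dec inImage? t w ×-dec T? (Graph.adj H u w)

    open Bipartition within-sym within?

    impossible : OddClosedWalk → ⊥
    impossible (_ , zero  , ()    , _)
    impossible (_ , suc ℓ , odd-ℓ , w) =
      no-odd-closed-walk-within og t (suc ℓ) _ odd-ℓ
        (record { edge = proj₂ ∘ proj₂ ∘ edge ; periodic = periodic }) (proj₁ ∘ edge)
      where open IsClosedWalk (closedWalk w)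

  edge-between-colours : (x : Fin 2 → V H) {a b : Bool} → a ≢ b →
                         E H (x (bit a)) (x (bit b)) ⇔ EH H x
  edge-between-colours x {false} {true}  _   = mk⇔ id id
  edge-between-colours x {true}  {false} _   = mk⇔ E-sym E-sym
  edge-between-colours x {false} {false} a≢b = ⊥-elim (a≢b refl)
  edge-between-colours x {true}  {true}  a≢b = ⊥-elim (a≢b refl)

  recolour∈R : ∀ {n} {R : Rel (V H) n} → PPolSubset (EH H) R → ∀ {t} → R t →
    (c : V H → Bool) → (∀ {u w} → EdgeWithin (InImage t) u w → c u ≢ c w) →
    ∀ x → EH H x → R (λ j → x (bit (c (t j))))
  recolour∈R pPol⊆ {t} Rt c proper x x-edge =
    pPol⊆ 1 dom f preserves (λ j _ → t j) (λ _ → Rt) (λ j → fromWitness (j , refl))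
    where
    dom : (Fin 1 → V H) → Bool
    dom v = isYes (inImage? t (v fzero))

    f : (v : Fin 1 → V H) → T (dom v) → V H
    f v _ = x (bit (c (v fzero)))

    preserves : Preserves (EH H) dom f
    preserves M columns rows = Equivalence.from (edge-between-colours x c≢) x-edge
      where
      c≢ : c (M fzero fzero) ≢ c (M (fsuc fzero) fzero)
      c≢ = proper (toWitness (rows fzero) , toWitness (rows (fsuc fzero)) , columns fzero)

lemma3p5 : (n : ℕ) → (n≥2 : 2 ≤ n) → (H : Graph) → OddGirthGT H n →
    (R : Rel (V H) n) → ∃ R → PPolSubset (EH H) R →
    (∀ (x : Fin n → V H) → R x → E H (x (idx₁ n≥2)) (x (idx₂ n≥2))) →
    QfppDefines R (EH H)
lemma3p5 n (s≤s (s≤s z≤n)) H og R (t , Rt) pPol⊆ R⇒E =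
  1 , (λ _ j → bit (c (t j))) , 0 , (λ ()) ,
  λ x → mk⇔ (λ x-edge → (λ _ → recolour∈R H {R = R} pPol⊆ Rt c proper x x-edge) , λ ())
            (λ (R-x , _) → Equivalence.to (edge-between-colours H x c₁≢c₂)
                                          (R⇒E _ (R-x fzero)))
  where
  c : V H → Bool
  c = proj₁ (bipartiteWithin H og t)

  proper : ∀ {u w} → EdgeWithin H (InImage t) u w → c u ≢ c w
  proper = proj₂ (bipartiteWithin H og t)

  c₁≢c₂ : c (t fzero) ≢ c (t (fsuc fzero))
  c₁≢c₂ = proper ((fzero , refl) , (fsuc fzero , refl) , R⇒E t Rt)
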